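{- Let $D$ be a finite subset of $\mathbb{N}^d\setminus\{0\}$ that is an antichain with respect to the natural partial ordering. Consider the collection of all generalized numerical semigroups $S\subseteq\mathbb{N}^d$ with $D\subseteq\mathcal{H}(S)$. The maximal members of this collection (with respect to set inclusion) are precisely the quasi-irreducible generalized numerical semigroups $S$ with $FA(S)=D$.
   Context: A GNS is a submonoid $S\subseteq\mathbb{N}^d$ with finite complement $\mathcal{H}(S)=\mathbb{N}^d\setminus S$ (gaps). Natural partial order: $x\le y$ iff $x^{(i)}\le y^{(i)}$ for all $i$. A relaxed monomial order is a total order $\prec$ on $\mathbb{N}^d$ with $v\prec w\Rightarrow v\prec w+u$ for all $u\in\mathbb{N}^d$ and $0\prec v$ for $v\ne 0$. A gap is Frobenius allowable if it is $\max_\prec\mathcal{H}(S)$ for some relaxed monomial order; $FA(S)$ is the set of Frobenius allowable gaps. $S$ is quasi-irreducible if for every $x\in\mathcal{H}(S)$, either $2x\in FA(S)$ or there is $F\in FA(S)$ with $F-x\in S$ (meaning $F-x\in\mathbb{N}^d$ and lies in $S$). -}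

module Defs where

open import Data.Nat using (ℕ; zero; suc; _+_; _*_; _∸_; _≤_)
open import Data.Bool using (Bool; true; false)
open import Data.Vec using (Vec; zipWith; replicate)
open import Data.Vec.Relation.Binary.Pointwise.Inductive using (Pointwise)
open import Data.List using (List)
open import Data.List.Membership.Propositional using (_∈_)
open import Data.Product using (Σ; _×_; ∃; ∃-syntax)
open import Data.Sum using (_⊎_)
open import Relation.Nullary using (¬_)
open import Relation.Binary.PropositionalEquality using (_≡_)
open import Relation.Binary.Definitions using (Trichotomous)
open import Relation.Binary.Structures using (IsStrictTotalOrder)
open import Function.Bundles using (_⇔_)

Pt : ℕ → Set
Pt d = Vec ℕ d

𝟘 : ∀ {d} → Pt d
𝟘 {d} = replicate d 0

_⊕_ : ∀ {d} → Pt d → Pt d → Pt d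
_⊕_ = zipWith _+_

-- componentwise truncated subtraction (only used when x ≼ y)
_⊖_ : ∀ {d} → Pt d → Pt d → Pt d
_⊖_ = zipWith _∸_

_≼_ : ∀ {d} → Pt d → Pt d → Set
_≼_ = Pointwise _≤_

Subset : ℕ → Set
Subset d = Pt d → Bool

_∈ₛ_ : ∀ {d} → Pt d → Subset d → Set
x ∈ₛ S = S x ≡ true

_∈H_ : ∀ {d} → Pt d → Subset d → Set
x ∈H S = S x ≡ false

_⊆ₛ_ : ∀ {d} → Subset d → Subset d → Set
S ⊆ₛ T = ∀ x → x ∈ₛ S → x ∈ₛ T

record IsGNS {d : ℕ} (S : Subset d) : Set where
  field
    zero∈    : 𝟘 ∈ₛ S
    closed+  : ∀ x y → x ∈ₛ S → y ∈ₛ S → (x ⊕ y) ∈ₛ S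
    gapsFinite : ∃[ L ] (∀ x → (x ∈H S) ⇔ (x ∈ L))

record IsRelaxedMonomialOrder {d : ℕ} (_≺_ : Pt d → Pt d → Set) : Set where
  field
    strictTotal : IsStrictTotalOrder _≡_ _≺_
    compat      : ∀ v w u → v ≺ w → v ≺ (w ⊕ u)
    zeroMin     : ∀ v → ¬ (v ≡ 𝟘) → 𝟘 ≺ v

IsMaxGap : ∀ {d} → (Pt d → Pt d → Set) → Subset d → Pt d → Set
IsMaxGap _≺_ S x = x ∈H S × (∀ h → h ∈H S → h ≡ x ⊎ h ≺ x)

_∈FA_ : ∀ {d} → Pt d → Subset d → Set₁
x ∈FA S = ∃[ _≺_ ] (IsRelaxedMonomialOrder _≺_ × IsMaxGap _≺_ S x)

QuasiIrreducible : ∀ {d} → Subset d → Set₁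
QuasiIrreducible S =
  ∀ x → x ∈H S →
    ((x ⊕ x) ∈FA S) ⊎ (∃[ F ] (F ∈FA S × x ≼ F × (F ⊖ x) ∈ₛ S))

Antichain : ∀ {d} → List (Pt d) → Set
Antichain D = ∀ a b → a ∈ D → b ∈ D → a ≼ b → a ≡ b

GapsContain : ∀ {d} → List (Pt d) → Subset d → Set
GapsContain D S = ∀ x → x ∈ D → x ∈H S

MaximalAvoiding : ∀ {d} → List (Pt d) → Subset d → Set
MaximalAvoiding D S =
  IsGNS S × GapsContain D S ×
  (∀ T → IsGNS T → GapsContain D T → S ⊆ₛ T → T ⊆ₛ S)

-- A GNS S that is maximal among those avoiding D admits no gap x ∉ D that could be
-- adjoined to it, i.e. with 2x ∈ S and x + (S ∖ {0}) ⊆ S; in particular every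
-- ≼-maximal gap lies in D. The ≼-maximal gaps are exactly the Frobenius allowable ones:
-- a relaxed monomial order extends ≼, and conversely a maximal gap x is the largest gap
-- for the order that compares the indicator of the up-set of x first and breaks ties
-- lexicographically. Hence FA(S) = D. Quasi-irreducibility follows by downward
-- induction over the finitely many gaps: if neither 2x ∈ D nor x + u ∈ D for some
-- u ∈ S, then inspecting the gaps x + s, x + 2s, 2x, 3x above x, together with the
-- antichain condition, shows that x could be adjoined to S. Conversely, if S is
-- quasi-irreducible with FA(S) = D, any v in a larger GNS T avoiding D would put 2v,
-- or some F = v + (F - v) ∈ D, into T.
module Submission where

open import Level using (0ℓ)
open import Function using (_∘_; case_of_; _⇔_; mk⇔; Equivalence)
open import Algebra.Bundles using (CommutativeMonoid)
open import Algebra.Structures using (IsCommutativeMonoid)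
import Algebra.Solver.CommutativeMonoid as CommutativeMonoidSolver
open import Data.Bool using (true; false)
import Data.Bool as Bool
open import Data.Product using (_×_; _,_; proj₁; proj₂; ∃-syntax)
open import Data.Sum using (_⊎_; inj₁; inj₂)
open import Data.Nat using (ℕ; suc; _∸_; _≤_; _<_; z≤n; _≤?_)
open import Data.Nat.Properties
  using (+-assoc; +-comm; +-identityˡ; +-identityʳ; +-cancelˡ-≡; m+n≡0⇒m≡0; m≤m+n;
         m+[n∸m]≡n; m+n∸m≡n; ≤-refl; ≤-trans; ≤-antisym; m≤n⇒m<n∨m≡n; +-mono-≤;
         +-mono-<-≤; +-monoʳ-<; ∸-monoʳ-<)
import Data.Nat.Properties as ℕ
open import Data.Nat.Induction using (<-wellFounded)
open import Data.Vec using ([]; _∷_; sum; head; tail)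
open import Data.Vec.Properties
  using (zipWith-assoc; zipWith-identityˡ; zipWith-identityʳ; zipWith-comm; ≡-dec)
open import Data.Vec.Relation.Binary.Pointwise.Inductive as Pointwise
  using ([]; _∷_; Pointwise-≡⇒≡; ≡⇒Pointwise-≡)
import Data.Vec.Relation.Binary.Lex.Strict as Lex
open Lex using (Lex-<)
open import Data.Vec.Relation.Binary.Lex.Core using (this; next)
open import Data.List using (List; filter)
open import Data.List.Relation.Unary.Any using (any?)
import Data.List.Relation.Unary.All as ListAll
open import Data.List.Membership.Propositional using (_∈_; _∉_; find; lose)
open import Data.List.Membership.Propositional.Properties using (∈-filter⁺; ∈-filter⁻)
import Data.List.Membership.DecPropositional as DecMembership
open import Data.List.Extrema.Nat using (argmax; f[xs]≤f[argmax])
open import Induction.WellFounded using (WellFounded; module Subrelation; module All)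
open import Relation.Nullary using (¬_; Dec; yes; no; ¬?; contradiction)
open import Relation.Nullary.Decidable using (_×-dec_; _⊎-dec_; map′; decidable-stable)
open import Relation.Binary.Definitions using (DecidableEquality; Trichotomous; tri<; tri≈; tri>)
open import Relation.Binary.Structures using (IsStrictTotalOrder)
open import Relation.Binary.Structures.Biased using (isStrictTotalOrderᶜ)
import Relation.Binary.Construct.On as On
open import Relation.Binary.PropositionalEquality

open import Defs

private
  variable
    d : ℕ
    x y z v : Pt d

-- The monoid ℕ^d and its natural partial order

⊕-isCommutativeMonoid : ∀ d → IsCommutativeMonoid _≡_ (_⊕_ {d}) 𝟘
⊕-isCommutativeMonoid d = record
  { isMonoid = record
    { isSemigroup = record
      { isMagma = record { isEquivalence = isEquivalence ; ∙-cong = cong₂ _⊕_ }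
      ; assoc = zipWith-assoc +-assoc }
    ; identity = zipWith-identityˡ +-identityˡ , zipWith-identityʳ +-identityʳ }
  ; comm = zipWith-comm +-comm }

⊕-commutativeMonoid : ℕ → CommutativeMonoid 0ℓ 0ℓ
⊕-commutativeMonoid d = record { isCommutativeMonoid = ⊕-isCommutativeMonoid d }

⊕-assoc : ∀ (x y z : Pt d) → (x ⊕ y) ⊕ z ≡ x ⊕ (y ⊕ z)
⊕-assoc = IsCommutativeMonoid.assoc (⊕-isCommutativeMonoid _)

⊕-comm : ∀ (x y : Pt d) → x ⊕ y ≡ y ⊕ x
⊕-comm = IsCommutativeMonoid.comm (⊕-isCommutativeMonoid _)

⊕-identityʳ : ∀ (x : Pt d) → x ⊕ 𝟘 ≡ x
⊕-identityʳ = IsCommutativeMonoid.identityʳ (⊕-isCommutativeMonoid _)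

⊕-cancelˡ : ∀ (x : Pt d) {y z} → x ⊕ y ≡ x ⊕ z → y ≡ z
⊕-cancelˡ []       {[]}    {[]}    _  = refl
⊕-cancelˡ (a ∷ x) {b ∷ y} {c ∷ z} eq =
  cong₂ _∷_ (+-cancelˡ-≡ a b c (cong head eq)) (⊕-cancelˡ x (cong tail eq))

x⊕y≡x⇒y≡𝟘 : x ⊕ y ≡ x → y ≡ 𝟘
x⊕y≡x⇒y≡𝟘 {x = x} eq = ⊕-cancelˡ x (trans eq (sym (⊕-identityʳ x)))

x⊕y≡𝟘⇒x≡𝟘 : ∀ (x : Pt d) {y} → x ⊕ y ≡ 𝟘 → x ≡ 𝟘
x⊕y≡𝟘⇒x≡𝟘 []       {[]}    _  = refl
x⊕y≡𝟘⇒x≡𝟘 (a ∷ x) {b ∷ y} eq =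
  cong₂ _∷_ (m+n≡0⇒m≡0 a (cong head eq)) (x⊕y≡𝟘⇒x≡𝟘 x (cong tail eq))

_≟ₚ_ : DecidableEquality (Pt d)
_≟ₚ_ = ≡-dec ℕ._≟_

_≼?_ : ∀ (x y : Pt d) → Dec (x ≼ y)
_≼?_ = Pointwise.decidable _≤?_

≼-refl : x ≼ x
≼-refl = Pointwise.refl ≤-refl

≼-trans : x ≼ y → y ≼ z → x ≼ z
≼-trans = Pointwise.trans ≤-trans

≼-antisym : x ≼ y → y ≼ x → x ≡ y
≼-antisym []       []       = refl
≼-antisym (p ∷ ps) (q ∷ qs) = cong₂ _∷_ (≤-antisym p q) (≼-antisym ps qs)

𝟘≼x : ∀ (x : Pt d) → 𝟘 ≼ x
𝟘≼x []      = []
𝟘≼x (_ ∷ x) = z≤n ∷ 𝟘≼x x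

x≼x⊕y : ∀ (x y : Pt d) → x ≼ (x ⊕ y)
x≼x⊕y []      []      = []
x≼x⊕y (a ∷ x) (b ∷ y) = m≤m+n a b ∷ x≼x⊕y x y

x⊕[y⊖x]≡y : x ≼ y → x ⊕ (y ⊖ x) ≡ y
x⊕[y⊖x]≡y []       = refl
x⊕[y⊖x]≡y (p ∷ ps) = cong₂ _∷_ (m+[n∸m]≡n p) (x⊕[y⊖x]≡y ps)

[x⊕y]⊖x≡y : ∀ (x y : Pt d) → (x ⊕ y) ⊖ x ≡ y
[x⊕y]⊖x≡y []      []      = refl
[x⊕y]⊖x≡y (a ∷ x) (b ∷ y) = cong₂ _∷_ (m+n∸m≡n a b) ([x⊕y]⊖x≡y x y)

_⊏_ : Pt d → Pt d → Set
x ⊏ y = x ≼ y × x ≢ y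

_⊏?_ : ∀ (x y : Pt d) → Dec (x ⊏ y)
x ⊏? y = (x ≼? y) ×-dec ¬? (x ≟ₚ y)

x⊏x⊕y : y ≢ 𝟘 → x ⊏ (x ⊕ y)
x⊏x⊕y {y = y} {x} y≢𝟘 = x≼x⊕y x y , λ eq → y≢𝟘 (x⊕y≡x⇒y≡𝟘 (sym eq))

≼⇒sum≤ : x ≼ y → sum x ≤ sum y
≼⇒sum≤ []       = ≤-refl
≼⇒sum≤ (p ∷ ps) = +-mono-≤ p (≼⇒sum≤ ps)

⊏⇒sum< : x ⊏ y → sum x < sum y
⊏⇒sum< ([] , x≢y) = contradiction refl x≢y
⊏⇒sum< {x = a ∷ x} (p ∷ ps , x≢y) with m≤n⇒m<n∨m≡n p
... | inj₁ a<b  = +-mono-<-≤ a<b (≼⇒sum≤ ps)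
... | inj₂ refl = +-monoʳ-< a (⊏⇒sum< (ps , λ eq → x≢y (cong (a ∷_) eq)))

⊏⇒<ₗₑₓ : x ⊏ y → Lex-< _≡_ _<_ x y
⊏⇒<ₗₑₓ ([] , x≢y) = contradiction refl x≢y
⊏⇒<ₗₑₓ {x = a ∷ x} (p ∷ ps , x≢y) with m≤n⇒m<n∨m≡n p
... | inj₁ a<b  = this a<b refl
... | inj₂ refl = next refl (⊏⇒<ₗₑₓ (ps , λ eq → x≢y (cong (a ∷_) eq)))

AboveIn : List (Pt d) → Pt d → Pt d → Set
AboveIn L y x = y ∈ L × x ⊏ y

aboveIn-wellFounded : ∀ (L : List (Pt d)) → WellFounded (AboveIn L)
aboveIn-wellFounded L = Subrelation.wellFounded shrinks (On.wellFounded room <-wellFounded)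
  where
  room : Pt _ → ℕ
  room x = sum (argmax sum 𝟘 L) ∸ sum x

  shrinks : AboveIn L y x → room y < room x
  shrinks (y∈L , x⊏y) = ∸-monoʳ-< (⊏⇒sum< x⊏y) (ListAll.lookup (f[xs]≤f[argmax] 𝟘 L) y∈L)

∈ₛ⊎∈H : ∀ (S : Subset d) x → x ∈ₛ S ⊎ x ∈H S
∈ₛ⊎∈H S x with S x
... | true  = inj₁ refl
... | false = inj₂ refl

∈ₛ⇒∉H : ∀ (S : Subset d) → x ∈ₛ S → ¬ x ∈H S
∈ₛ⇒∉H _ x∈S x∈H with () ← trans (sym x∈S) x∈H

¬∈H⇒∈ₛ : ∀ (S : Subset d) → ¬ x ∈H S → x ∈ₛ S
¬∈H⇒∈ₛ {x = x} S x∉H with S x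
... | true  = refl
... | false = contradiction refl x∉H

-- Relaxed monomial orders and Frobenius allowable gaps

⊏⇒≺ : ∀ {_≺_ : Pt d → Pt d → Set} → IsRelaxedMonomialOrder _≺_ → x ⊏ y → x ≺ y
⊏⇒≺ {x = x} {y = y} {_≺_ = _≺_} ≺-relaxed (x≼y , x≢y) with compare x y
  where open IsStrictTotalOrder (IsRelaxedMonomialOrder.strictTotal ≺-relaxed)
... | tri< x≺y _ _ = x≺y
... | tri≈ _ x≡y _ = contradiction x≡y x≢y
... | tri> _ _ y≺x =
  contradiction (subst (y ≺_) (x⊕[y⊖x]≡y x≼y) (compat y x (y ⊖ x) y≺x)) (irrefl refl)
  where open IsRelaxedMonomialOrder ≺-relaxed
        open IsStrictTotalOrder strictTotal

module GradedLex {d : ℕ} (c : Pt d → ℕ) (c-mono : ∀ {x y} → x ≼ y → c x ≤ c y) where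

  _≺_ : Pt d → Pt d → Set
  x ≺ y = Lex-< _≡_ _<_ (c x ∷ x) (c y ∷ y)

  c<⇒≺ : c x < c y → x ≺ y
  c<⇒≺ cx<cy = this cx<cy refl

  private
    ⊏⇒≺ᶜ : x ⊏ y → x ≺ y
    ⊏⇒≺ᶜ x⊏y with m≤n⇒m<n∨m≡n (c-mono (proj₁ x⊏y))
    ... | inj₁ cx<cy = c<⇒≺ cx<cy
    ... | inj₂ cx≡cy = next cx≡cy (⊏⇒<ₗₑₓ x⊏y)

    module Lexᵒ = IsStrictTotalOrder (Lex.<-isStrictTotalOrder ℕ.<-isStrictTotalOrder {suc d})

  compare : Trichotomous _≡_ _≺_
  compare x y with Lexᵒ.compare (c x ∷ x) (c y ∷ y)
  ... | tri< x≺y x≉y x⊁y = tri< x≺y (x≉y ∘ ≡⇒Pointwise-≡ ∘ cong (λ v → c v ∷ v)) x⊁y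
  ... | tri≈ x⊀y x≈y x⊁y = tri≈ x⊀y (cong tail (Pointwise-≡⇒≡ x≈y)) x⊁y
  ... | tri> x⊀y x≉y x≻y = tri> x⊀y (x≉y ∘ ≡⇒Pointwise-≡ ∘ cong (λ v → c v ∷ v)) x≻y

  isRelaxedMonomialOrder : IsRelaxedMonomialOrder _≺_
  isRelaxedMonomialOrder = record
    { strictTotal = isStrictTotalOrderᶜ record
      { isEquivalence = isEquivalence ; trans = Lexᵒ.trans ; compare = compare }
    ; compat = λ x y u x≺y → grow x≺y (y ≟ₚ (y ⊕ u)) (x≼x⊕y y u)
    ; zeroMin = λ x x≢𝟘 → ⊏⇒≺ᶜ (𝟘≼x x , x≢𝟘 ∘ sym) }
    where
    grow : ∀ {x y z} → x ≺ y → Dec (y ≡ z) → y ≼ z → x ≺ z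
    grow x≺y (yes refl) _   = x≺y
    grow x≺y (no y≢z)   y≼z = Lexᵒ.trans x≺y (⊏⇒≺ᶜ (y≼z , y≢z))

IsMaximalGap : Subset d → Pt d → Set
IsMaximalGap S x = x ∈H S × (∀ y → y ∈H S → x ≼ y → x ≡ y)

maximalGap-⊏-∈ₛ : ∀ {S : Subset d} → IsMaximalGap S x → x ⊏ y → y ∈ₛ S
maximalGap-⊏-∈ₛ {y = y} {S} (_ , maximal) (x≼y , x≢y) =
  ¬∈H⇒∈ₛ S λ y∈H → x≢y (maximal y y∈H x≼y)

FA⇒maximalGap : ∀ {S : Subset d} → x ∈FA S → IsMaximalGap S x
FA⇒maximalGap {x = x} {S} (_≺_ , ≺-relaxed , x∈H , x-max) = x∈H , maximal
  where
  open IsStrictTotalOrder (IsRelaxedMonomialOrder.strictTotal ≺-relaxed)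
    renaming (irrefl to ≺-irrefl; trans to ≺-trans)
  maximal : ∀ y → y ∈H S → x ≼ y → x ≡ y
  maximal y y∈H x≼y with x ≟ₚ y | x-max y y∈H
  ... | yes x≡y | _       = x≡y
  ... | no _    | inj₁ y≡x = sym y≡x
  ... | no x≢y  | inj₂ y≺x =
    contradiction (≺-trans (⊏⇒≺ ≺-relaxed (x≼y , x≢y)) y≺x) (≺-irrefl refl)

upsetIndicator : Pt d → Pt d → ℕ
upsetIndicator x v with x ≼? v
... | yes _ = 1
... | no _  = 0

upsetIndicator-mono : ∀ (x : Pt d) {v w} → v ≼ w → upsetIndicator x v ≤ upsetIndicator x w
upsetIndicator-mono x {v} {w} v≼w with x ≼? v | x ≼? w
... | yes _   | yes _   = ≤-refl
... | yes x≼v | no x⋠w = contradiction (≼-trans x≼v v≼w) x⋠w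
... | no _    | _       = z≤n

upsetIndicator-outside : ¬ x ≼ v → upsetIndicator x v < upsetIndicator x x
upsetIndicator-outside {x = x} {v = v} x⋠v with x ≼? v | x ≼? x
... | yes x≼v | _       = contradiction x≼v x⋠v
... | no _    | yes _   = ℕ.0<1+n
... | no _    | no x⋠x = contradiction ≼-refl x⋠x

maximalGap⇒FA : ∀ {S : Subset d} → IsMaximalGap S x → x ∈FA S
maximalGap⇒FA {x = x} {S} (x∈H , maximal) = _≺_ , isRelaxedMonomialOrder , x∈H , x-max
  where
  open GradedLex (upsetIndicator x) (upsetIndicator-mono x)

  x-max : ∀ h → h ∈H S → h ≡ x ⊎ h ≺ x
  x-max h h∈H = case x ≼? h of λ where
    (yes x≼h) → inj₁ (sym (maximal h h∈H x≼h))
    (no x⋠h)  → inj₂ (c<⇒≺ (upsetIndicator-outside x⋠h))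

-- Gaps of a GNS, and adjoining one

Adjoinable : Subset d → Pt d → Set
Adjoinable S x = (x ⊕ x) ∈ₛ S × (∀ s → s ∈ₛ S → s ≢ 𝟘 → (x ⊕ s) ∈ₛ S)

insert : Pt d → Subset d → Subset d
insert x S v with v ≟ₚ x
... | yes _ = true
... | no _  = S v

module Insert {d : ℕ} (x : Pt d) (S : Subset d) where

  x∈insert : x ∈ₛ insert x S
  x∈insert with x ≟ₚ x
  ... | yes _  = refl
  ... | no x≢x = contradiction refl x≢x

  ∈ₛ⇒∈insert : ∀ v → v ∈ₛ S → v ∈ₛ insert x S
  ∈ₛ⇒∈insert v v∈S with v ≟ₚ x
  ... | yes _ = refl
  ... | no _  = v∈S

  ∈insert⇒ : ∀ v → v ∈ₛ insert x S → v ≡ x ⊎ v ∈ₛ S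
  ∈insert⇒ v v∈T with v ≟ₚ x
  ... | yes v≡x = inj₁ v≡x
  ... | no _    = inj₂ v∈T

  ∈H-insert : ∀ v → v ∈H insert x S ⇔ (v ∈H S × v ≢ x)
  ∈H-insert v with v ≟ₚ x
  ... | yes v≡x = mk⇔ (λ ()) (λ (_ , v≢x) → contradiction v≡x v≢x)
  ... | no v≢x  = mk⇔ (_, v≢x) proj₁

  insert-gaps : ∀ {L} → (∀ v → v ∈H S ⇔ v ∈ L) →
                ∀ v → v ∈H insert x S ⇔ v ∈ filter (¬? ∘ (_≟ₚ x)) L
  insert-gaps gaps-S v = mk⇔
    (λ v∈H′ → let v∈H , v≢x = Equivalence.to (∈H-insert v) v∈H′
              in ∈-filter⁺ (¬? ∘ (_≟ₚ x)) (Equivalence.to (gaps-S v) v∈H) v≢x)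
    (λ v∈L′ → let v∈L , v≢x = ∈-filter⁻ (¬? ∘ (_≟ₚ x)) v∈L′
              in Equivalence.from (∈H-insert v) (Equivalence.from (gaps-S v) v∈L , v≢x))

module GNS {d : ℕ} {S : Subset d} (S-gns : IsGNS S) where
  open IsGNS S-gns

  gap≢𝟘 : x ∈H S → x ≢ 𝟘
  gap≢𝟘 x∈H refl = ∈ₛ⇒∉H S zero∈ x∈H

  gaps : List (Pt d)
  gaps = proj₁ gapsFinite

  ∈H⇔∈gaps : x ∈H S ⇔ x ∈ gaps
  ∈H⇔∈gaps = proj₂ gapsFinite _

  gap-above? : ∀ x → Dec (∃[ y ] (y ∈H S × x ⊏ y))
  gap-above? x = map′
    (λ above → let y , y∈gaps , x⊏y = find above
               in y , Equivalence.from ∈H⇔∈gaps y∈gaps , x⊏y)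
    (λ (y , y∈H , x⊏y) → lose (Equivalence.to ∈H⇔∈gaps y∈H) x⊏y)
    (any? (x ⊏?_) gaps)

  gap-induction : ∀ (P : Pt d → Set) →
                  (∀ x → (∀ y → y ∈H S → x ⊏ y → P y) → P x) → ∀ x → P x
  gap-induction P step = All.wfRec (aboveIn-wellFounded gaps) 0ℓ P
    λ x rec → step x λ y y∈H x⊏y → rec (Equivalence.to ∈H⇔∈gaps y∈H , x⊏y)

  maximalGap-above : x ∈H S → ∃[ m ] (IsMaximalGap S m × x ≼ m)
  maximalGap-above {x = x} = gap-induction (λ x → x ∈H S → MaximalGapAbove x) step x
    where
    MaximalGapAbove : Pt d → Set
    MaximalGapAbove x = ∃[ m ] (IsMaximalGap S m × x ≼ m)

    step : ∀ x → (∀ y → y ∈H S → x ⊏ y → y ∈H S → MaximalGapAbove y) →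
           x ∈H S → MaximalGapAbove x
    step x rec x∈H with gap-above? x
    ... | yes (y , y∈H , x⊏y) = let m , m-max , y≼m = rec y y∈H x⊏y y∈H
                                in m , m-max , ≼-trans (proj₁ x⊏y) y≼m
    ... | no no-gap-above = x , (x∈H , maximal) , ≼-refl
      where
      maximal : ∀ y → y ∈H S → x ≼ y → x ≡ y
      maximal y y∈H x≼y =
        decidable-stable (x ≟ₚ y) λ x≢y → no-gap-above (y , y∈H , x≼y , x≢y)

  maximalGap⇒adjoinable : IsMaximalGap S x → Adjoinable S x
  maximalGap⇒adjoinable x-max@(x∈H , _) =
      maximalGap-⊏-∈ₛ x-max (x⊏x⊕y (gap≢𝟘 x∈H))
    , λ s _ s≢𝟘 → maximalGap-⊏-∈ₛ x-max (x⊏x⊕y s≢𝟘)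

  insert-isGNS : Adjoinable S x → IsGNS (insert x S)
  insert-isGNS {x = x} (x⊕x∈S , x⊕S⊆S) = record
    { zero∈      = ∈ₛ⇒∈insert 𝟘 zero∈
    ; closed+    = closed
    ; gapsFinite = _ , insert-gaps (proj₂ gapsFinite) }
    where
    open Insert x S
    x⊕∈insert : ∀ s → s ∈ₛ S → (x ⊕ s) ∈ₛ insert x S
    x⊕∈insert s s∈S with s ≟ₚ 𝟘
    ... | yes refl = subst (_∈ₛ insert x S) (sym (⊕-identityʳ x)) x∈insert
    ... | no s≢𝟘   = ∈ₛ⇒∈insert _ (x⊕S⊆S s s∈S s≢𝟘)

    closed : ∀ a b → a ∈ₛ insert x S → b ∈ₛ insert x S → (a ⊕ b) ∈ₛ insert x S
    closed a b a∈T b∈T with ∈insert⇒ a a∈T | ∈insert⇒ b b∈T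
    ... | inj₁ refl | inj₁ refl = ∈ₛ⇒∈insert _ x⊕x∈S
    ... | inj₁ refl | inj₂ b∈S  = x⊕∈insert b b∈S
    ... | inj₂ a∈S  | inj₁ refl = subst (_∈ₛ insert x S) (⊕-comm x a) (x⊕∈insert a a∈S)
    ... | inj₂ a∈S  | inj₂ b∈S  = ∈ₛ⇒∈insert _ (closed+ a b a∈S b∈S)

-- GNSs maximal among those avoiding D

antichain-⊕ : ∀ {D : List (Pt d)} {u} → Antichain D → x ∈ D → (x ⊕ u) ∈ D → u ≡ 𝟘
antichain-⊕ {x = x} {u = u} anti x∈D x⊕u∈D =
  x⊕y≡x⇒y≡𝟘 (sym (anti _ _ x∈D x⊕u∈D (x≼x⊕y x u)))

_≤[_]_ : Pt d → Subset d → Pt d → Set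
x ≤[ S ] F = x ≼ F × (F ⊖ x) ∈ₛ S

x≤[S]x⊕u : ∀ (S : Subset d) {u} → u ∈ₛ S → x ≤[ S ] (x ⊕ u)
x≤[S]x⊕u {x = x} S {u} u∈S = x≼x⊕y x u , subst (_∈ₛ S) (sym ([x⊕y]⊖x≡y x u)) u∈S

module MaximalAvoidingGNS {d : ℕ} {D : List (Pt d)} {S : Subset d} (anti : Antichain D)
                          (S-max : MaximalAvoiding D S) where
  private
    S-gns : IsGNS S
    S-gns = proj₁ S-max

    D⊆H : GapsContain D S
    D⊆H = proj₁ (proj₂ S-max)

  open IsGNS S-gns
  open GNS S-gns
  open DecMembership (_≟ₚ_ {d}) using (_∈?_)

  adjoinable-gap∈D : x ∈H S → Adjoinable S x → x ∈ D
  adjoinable-gap∈D {x = x} x∈H x-adj = decidable-stable (x ∈? D) λ x∉D →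
    let open Insert x S
        D⊆H′ : GapsContain D (insert x S)
        D⊆H′ y y∈D = Equivalence.from (∈H-insert y) (D⊆H y y∈D , λ { refl → x∉D y∈D })
        x∈S = proj₂ (proj₂ S-max) (insert x S) (insert-isGNS x-adj) D⊆H′
                ∈ₛ⇒∈insert x x∈insert
    in ∈ₛ⇒∉H S x∈S x∈H

  maximalGap∈D : IsMaximalGap S x → x ∈ D
  maximalGap∈D x-max = adjoinable-gap∈D (proj₁ x-max) (maximalGap⇒adjoinable x-max)

  ∈D⇒maximalGap : x ∈ D → IsMaximalGap S x
  ∈D⇒maximalGap {x = x} x∈D = D⊆H x x∈D , maximal
    where
    maximal : ∀ y → y ∈H S → x ≼ y → x ≡ y
    maximal y y∈H x≼y =
      let m , m-max , y≼m = maximalGap-above y∈H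
          x≡m = anti x m x∈D (maximalGap∈D m-max) (≼-trans x≼y y≼m)
      in ≼-antisym x≼y (subst (y ≼_) (sym x≡m) y≼m)

  FA⇔∈D : x ∈FA S ⇔ x ∈ D
  FA⇔∈D = mk⇔ (maximalGap∈D ∘ FA⇒maximalGap) (maximalGap⇒FA ∘ ∈D⇒maximalGap)

  Reach : Pt d → Set
  Reach x = ∃[ u ] (u ∈ₛ S × (x ⊕ u) ∈ D)

  reach? : ∀ x → Dec (Reach x)
  reach? x = map′
    (λ found → let F , F∈D , x≼F , F⊖x∈S = find {P = x ≤[ S ]_} found
               in F ⊖ x , F⊖x∈S , subst (_∈ D) (sym (x⊕[y⊖x]≡y x≼F)) F∈D)
    (λ (u , u∈S , x⊕u∈D) → lose x⊕u∈D (x≤[S]x⊕u S u∈S))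
    (any? (λ F → (x ≼? F) ×-dec (S (F ⊖ x) Bool.≟ true)) D)

  -- Quasi-irreducibility at x with D in place of FA(S); in this form it is decidable.
  Covered : Pt d → Set
  Covered x = (x ⊕ x) ∈ D ⊎ Reach x

  covered? : ∀ x → Dec (Covered x)
  covered? x = ((x ⊕ x) ∈? D) ⊎-dec reach? x

  module UncoveredGap (x : Pt d) (x≢𝟘 : x ≢ 𝟘)
                      (covered-above : ∀ y → y ∈H S → x ⊏ y → Covered y)
                      (uncovered : ¬ Covered x) where
    open CommutativeMonoidSolver (⊕-commutativeMonoid d)
      using (solve; _⊜_) renaming (_⊕_ to _+ₑ_)

    unreachable : ∀ u → u ∈ₛ S → (x ⊕ u) ∉ D
    unreachable u u∈S x⊕u∈D = uncovered (inj₂ (u , u∈S , x⊕u∈D))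

    reach-above⇒∈D : ∀ w → (∀ u → u ∈ₛ S → u ≢ 𝟘 → (w ⊕ u) ∈ₛ S) →
                     Reach (x ⊕ w) → (x ⊕ w) ∈ D
    reach-above⇒∈D w w⊕S⊆S (u , u∈S , x⊕w⊕u∈D) with u ≟ₚ 𝟘
    ... | yes refl = subst (_∈ D) (⊕-identityʳ (x ⊕ w)) x⊕w⊕u∈D
    ... | no u≢𝟘   = contradiction (subst (_∈ D) (⊕-assoc x w u) x⊕w⊕u∈D)
                                   (unreachable (w ⊕ u) (w⊕S⊆S u u∈S u≢𝟘))

    x⊕S⊆S : ∀ s → s ∈ₛ S → s ≢ 𝟘 → (x ⊕ s) ∈ₛ S
    x⊕S⊆S s s∈S s≢𝟘 = ¬∈H⇒∈ₛ S λ a∈H →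
      case covered-above a a∈H (x⊏x⊕y s≢𝟘) of λ where
        (inj₂ (u , u∈S , a⊕u∈D)) →
          unreachable (s ⊕ u) (closed+ s u s∈S u∈S) (subst (_∈ D) (⊕-assoc x s u) a⊕u∈D)
        (inj₁ 2a∈D) → case ∈ₛ⊎∈H S b of λ where
          (inj₁ b∈S) → unreachable b b∈S (subst (_∈ D) 2a≡x⊕b 2a∈D)
          (inj₂ b∈H) → case covered-above b b∈H (x⊏x⊕y 2s≢𝟘) of λ where
            (inj₁ 2b∈D) → 2s≢𝟘 (antichain-⊕ anti 2a∈D (subst (_∈ D) 2b≡2a⊕2s 2b∈D))
            (inj₂ (u , u∈S , b⊕u∈D)) →
              unreachable ((s ⊕ s) ⊕ u) (closed+ _ u (closed+ s s s∈S s∈S) u∈S)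
                          (subst (_∈ D) (⊕-assoc x (s ⊕ s) u) b⊕u∈D)
      where
      a b : Pt d
      a = x ⊕ s
      b = x ⊕ (s ⊕ s)

      2s≢𝟘 : (s ⊕ s) ≢ 𝟘
      2s≢𝟘 = s≢𝟘 ∘ x⊕y≡𝟘⇒x≡𝟘 s

      2a≡x⊕b : a ⊕ a ≡ x ⊕ b
      2a≡x⊕b = solve 2 (λ x s → (x +ₑ s) +ₑ (x +ₑ s) ⊜ x +ₑ (x +ₑ (s +ₑ s))) refl x s

      2b≡2a⊕2s : b ⊕ b ≡ (a ⊕ a) ⊕ (s ⊕ s)
      2b≡2a⊕2s = solve 2 (λ x s → (x +ₑ (s +ₑ s)) +ₑ (x +ₑ (s +ₑ s))
                                   ⊜ ((x +ₑ s) +ₑ (x +ₑ s)) +ₑ (s +ₑ s)) refl x s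

    x⊕x∈S : (x ⊕ x) ∈ₛ S
    x⊕x∈S = ¬∈H⇒∈ₛ S λ 2x∈H →
      case covered-above (x ⊕ x) 2x∈H (x⊏x⊕y x≢𝟘) of λ where
        (inj₂ reach-2x) → uncovered (inj₁ (reach-above⇒∈D x x⊕S⊆S reach-2x))
        (inj₁ 4x∈D) → case ∈ₛ⊎∈H S 3x of λ where
          (inj₁ 3x∈S) → unreachable 3x 3x∈S (subst (_∈ D) 4x≡x⊕3x 4x∈D)
          (inj₂ 3x∈H) → case covered-above 3x 3x∈H (x⊏x⊕y 2x≢𝟘) of λ where
            (inj₁ 6x∈D)     → 2x≢𝟘 (antichain-⊕ anti 4x∈D (subst (_∈ D) 6x≡4x⊕2x 6x∈D))
            (inj₂ reach-3x) → x≢𝟘 (antichain-⊕ anti (reach-above⇒∈D (x ⊕ x) 2x⊕S⊆S reach-3x)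
                                                   (subst (_∈ D) 4x≡3x⊕x 4x∈D))
      where
      2x≢𝟘 : (x ⊕ x) ≢ 𝟘
      2x≢𝟘 = x≢𝟘 ∘ x⊕y≡𝟘⇒x≡𝟘 x

      3x : Pt d
      3x = x ⊕ (x ⊕ x)

      2x⊕S⊆S : ∀ u → u ∈ₛ S → u ≢ 𝟘 → ((x ⊕ x) ⊕ u) ∈ₛ S
      2x⊕S⊆S u u∈S u≢𝟘 = subst (_∈ₛ S) (sym (⊕-assoc x x u))
                            (x⊕S⊆S (x ⊕ u) (x⊕S⊆S u u∈S u≢𝟘) (x≢𝟘 ∘ x⊕y≡𝟘⇒x≡𝟘 x))

      4x≡x⊕3x : (x ⊕ x) ⊕ (x ⊕ x) ≡ x ⊕ 3x
      4x≡x⊕3x = solve 1 (λ x → (x +ₑ x) +ₑ (x +ₑ x) ⊜ x +ₑ (x +ₑ (x +ₑ x))) refl x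

      4x≡3x⊕x : (x ⊕ x) ⊕ (x ⊕ x) ≡ 3x ⊕ x
      4x≡3x⊕x = solve 1 (λ x → (x +ₑ x) +ₑ (x +ₑ x) ⊜ (x +ₑ (x +ₑ x)) +ₑ x) refl x

      6x≡4x⊕2x : 3x ⊕ 3x ≡ ((x ⊕ x) ⊕ (x ⊕ x)) ⊕ (x ⊕ x)
      6x≡4x⊕2x = solve 1 (λ x → (x +ₑ (x +ₑ x)) +ₑ (x +ₑ (x +ₑ x))
                                ⊜ ((x +ₑ x) +ₑ (x +ₑ x)) +ₑ (x +ₑ x)) refl x

    adjoinable : Adjoinable S x
    adjoinable = x⊕x∈S , x⊕S⊆S

  gap⇒covered : x ∈H S → Covered x
  gap⇒covered {x = x} = gap-induction (λ x → x ∈H S → Covered x) step x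
    where
    step : ∀ x → (∀ y → y ∈H S → x ⊏ y → y ∈H S → Covered y) → x ∈H S → Covered x
    step x covered-above x∈H = decidable-stable (covered? x) λ uncovered →
      let open UncoveredGap x (gap≢𝟘 x∈H) (λ y y∈H x⊏y → covered-above y y∈H x⊏y y∈H) uncovered
          x∈D = adjoinable-gap∈D x∈H adjoinable
      in unreachable 𝟘 zero∈ (subst (_∈ D) (sym (⊕-identityʳ x)) x∈D)

  quasiIrreducible : QuasiIrreducible S
  quasiIrreducible x x∈H = fromCovered (gap⇒covered {x = x} x∈H)
    where
    fromCovered : Covered x → ((x ⊕ x) ∈FA S) ⊎ (∃[ F ] (F ∈FA S × x ≤[ S ] F))
    fromCovered (inj₁ 2x∈D)              = inj₁ (Equivalence.from FA⇔∈D 2x∈D)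
    fromCovered (inj₂ (u , u∈S , x⊕u∈D)) =
      inj₂ (x ⊕ u , Equivalence.from FA⇔∈D x⊕u∈D , x≤[S]x⊕u S u∈S)

quasiIrreducible⇒maximalAvoiding : ∀ {D : List (Pt d)} {S : Subset d} →
  IsGNS S → QuasiIrreducible S → (∀ x → x ∈FA S ⇔ x ∈ D) → MaximalAvoiding D S
quasiIrreducible⇒maximalAvoiding {D = D} {S} S-gns S-qi FA⇔D = S-gns , D⊆H , maximal
  where
  D⊆H : GapsContain D S
  D⊆H x x∈D = proj₁ (FA⇒maximalGap (Equivalence.from (FA⇔D x) x∈D))

  maximal : ∀ T → IsGNS T → GapsContain D T → S ⊆ₛ T → T ⊆ₛ S
  maximal T T-gns D⊆H′ S⊆T v v∈T = ¬∈H⇒∈ₛ S (λ v∈H → escape (S-qi v v∈H))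
    where
    open IsGNS T-gns

    ∉T : ∀ {w} → w ∈ D → ¬ w ∈ₛ T
    ∉T {w} w∈D w∈T = ∈ₛ⇒∉H T w∈T (D⊆H′ w w∈D)

    escape : ¬ (((v ⊕ v) ∈FA S) ⊎ (∃[ F ] (F ∈FA S × v ≤[ S ] F)))
    escape (inj₁ 2v∈FA) = ∉T (Equivalence.to (FA⇔D (v ⊕ v)) 2v∈FA) (closed+ v v v∈T v∈T)
    escape (inj₂ (F , F∈FA , v≼F , F⊖v∈S)) = ∉T (Equivalence.to (FA⇔D F) F∈FA)
      (subst (_∈ₛ T) (x⊕[y⊖x]≡y v≼F) (closed+ v (F ⊖ v) v∈T (S⊆T (F ⊖ v) F⊖v∈S)))

theorem3p2 : (d : ℕ) (D : List (Pt d)) →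
    (∀ x → x ∈ D → ¬ (x ≡ 𝟘)) → Antichain D →
    (S : Subset d) → IsGNS S →
    MaximalAvoiding D S ⇔ (QuasiIrreducible S × (∀ x → (x ∈FA S) ⇔ (x ∈ D)))
theorem3p2 d D _ anti S S-gns = mk⇔
  (λ S-max → let open MaximalAvoidingGNS anti S-max in quasiIrreducible , λ _ → FA⇔∈D)
  (λ (S-qi , FA⇔D) → quasiIrreducible⇒maximalAvoiding S-gns S-qi FA⇔D)
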